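{- Let $K$ be a finite simplicial complex and let $K\mapsto K'$ be an admissible contraction identifying the vertex $v_0$ with the vertex $v_1$, so that $K'=\{T: v_0\notin T\in K\}\cup\{(T\setminus\{v_0\})\cup\{v_1\}: v_0\in T\in K\}$. Let $F\in K'$ with $F\notin K$, and let $v\in F$. Then $F\setminus\{v\}\in K$ if and only if $(F\setminus\{v\})\cup\{v_0\}\in K$.
   Context: A set $T$ is a missing face of $K$ if $T\notin K$ but every proper subset of $T$ is in $K$. The contraction identifying distinct vertices $v_0,v_1$ is admissible if no missing face of $K$ of dimension $\le\dim K$ contains both $v_0$ and $v_1$. -}

module Defs where

open import Data.Nat using (ℕ; _≤_)
open import Data.Fin using (Fin)
open import Data.Fin.Subset using (Subset; _∈_; _∉_; _⊆_; _⊂_; _∪_; _-_; ⁅_⁆; ∣_∣) renaming (⊥ to ∅)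
open import Data.Product using (Σ; _×_; ∃)
open import Data.Empty using (⊥)
open import Data.Sum using (_⊎_)
open import Relation.Nullary using (¬_; Dec)
open import Relation.Binary.PropositionalEquality using (_≡_)

-- Membership is decidable (automatic for a finite family of finite sets).
record SimplicialComplex (n : ℕ) : Set₁ where
  field
    face       : Subset n → Set
    face?      : (T : Subset n) → Dec (face T)
    downClosed : ∀ {S T} → S ⊆ T → face T → face S
    hasEmpty   : face ∅
open SimplicialComplex public

module _ {n : ℕ} (K : SimplicialComplex n) where

  MissingFace : Subset n → Set
  MissingFace T = ¬ face K T × (∀ S → S ⊂ T → face K S)

  -- dim T ≤ dim K, i.e. |T| - 1 ≤ max_{S ∈ K} (|S| - 1), i.e. some face S of K
  -- has at least as many vertices as T.
  DimAtMostDimK : Subset n → Set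
  DimAtMostDimK T = ∃ λ S → face K S × ∣ T ∣ ≤ ∣ S ∣

  Admissible : Fin n → Fin n → Set
  Admissible v₀ v₁ =
    ¬ (v₀ ≡ v₁) ×
    (∀ T → MissingFace T → DimAtMostDimK T → v₀ ∈ T → v₁ ∈ T → ⊥)

  ContractedFace : Fin n → Fin n → Subset n → Set
  ContractedFace v₀ v₁ F =
    (v₀ ∉ F × face K F) ⊎
    (∃ λ T → v₀ ∈ T × face K T × F ≡ (T - v₀) ∪ ⁅ v₁ ⁆)

{-# OPTIONS --safe #-}
module Submission where

-- Write F = (T - v₀) ∪ ⁅ v₁ ⁆ with v₀ ∈ T ∈ K, and G = (F - v) ∪ ⁅ v₀ ⁆.
-- One direction is closure under subsets.  For the other, G - v₀ ⊆ F - v and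
-- G - v₁ ⊆ T are faces, and ∣ G ∣ ≤ ∣ F ∣ ≤ ∣ T ∣.  If G were not a face, a
-- minimal non-face M ⊆ G would be a missing face of dimension ≤ dim K; it
-- contains v₀ and v₁, since otherwise it would lie in G - v₀ or G - v₁.
-- That contradicts admissibility.

open import Defs
open import Data.Nat using (ℕ; suc; _≤_; s≤s)
open import Data.Nat.Properties using (≤-refl; ≤-trans; n≤1+n)
open import Data.Nat.Induction using (<-wellFounded)
open import Data.Fin using (Fin; zero; suc)
open import Data.Fin.Properties using (any?)
open import Data.Fin.Subset using (Subset; _∈_; _∉_; _⊆_; _⊂_; _-_; _∪_; ⁅_⁆; ∣_∣; inside; outside)
open import Data.Fin.Subset.Properties
  using (_∈?_; x∈⁅y⁆⇒x≡y; ⊆-refl; ⊆-trans; p⊆q⇒∣p∣≤∣q∣; p⊂q⇒∣p∣<∣q∣; ∪-identityʳ; p⊆p∪q; x∈p∪q⁻;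
         p─q⊆p; x∈p∧x≢y⇒x∈p-y; x∈p⇒p-x⊂p; x∈p⇒∣p-x∣<∣p∣)
open import Data.Vec using (_∷_; there)
open import Data.Product using (_×_; _,_; ∃)
open import Data.Sum using (inj₁; inj₂)
open import Data.Empty using (⊥-elim)
open import Induction.WellFounded using (WellFounded; Acc; acc; module Subrelation)
import Relation.Binary.Construct.On as On
open import Relation.Nullary using (¬_; yes; no; ¬?)
open import Relation.Nullary.Decidable using (_×-dec_; decidable-stable)
open import Relation.Binary.PropositionalEquality using (_≡_; refl; sym; subst)

private
  variable
    n : ℕ

x∉p-x : (p : Subset n) (x : Fin n) → x ∉ p - x
x∉p-x (_ ∷ p) zero    ()
x∉p-x (_ ∷ p) (suc x) (there x∈p-x) = x∉p-x p x x∈p-x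

x∈p-y⇒x≢y : {p : Subset n} {x y : Fin n} → x ∈ p - y → ¬ x ≡ y
x∈p-y⇒x≢y {p = p} {x} x∈p-y refl = x∉p-x p x x∈p-y

p⊆q∧x∉p⇒p⊆q-x : {p q : Subset n} {x : Fin n} → p ⊆ q → x ∉ p → p ⊆ q - x
p⊆q∧x∉p⇒p⊆q-x p⊆q x∉p y∈p = x∈p∧x≢y⇒x∈p-y (p⊆q y∈p) λ { refl → x∉p y∈p }

p∪⁅x⁆-x⊆p : (p : Subset n) (x : Fin n) → (p ∪ ⁅ x ⁆) - x ⊆ p
p∪⁅x⁆-x⊆p p x y∈p∪⁅x⁆-x with x∈p∪q⁻ p ⁅ x ⁆ (p─q⊆p (p ∪ ⁅ x ⁆) ⁅ x ⁆ y∈p∪⁅x⁆-x)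
... | inj₁ y∈p   = y∈p
... | inj₂ y∈⁅x⁆ = ⊥-elim (x∈p-y⇒x≢y y∈p∪⁅x⁆-x (x∈⁅y⁆⇒x≡y x y∈⁅x⁆))

∣p∪⁅x⁆∣≤suc∣p∣ : (p : Subset n) (x : Fin n) → ∣ p ∪ ⁅ x ⁆ ∣ ≤ suc ∣ p ∣
∣p∪⁅x⁆∣≤suc∣p∣ (inside  ∷ p) zero    rewrite ∪-identityʳ p = n≤1+n (suc ∣ p ∣)
∣p∪⁅x⁆∣≤suc∣p∣ (outside ∷ p) zero    rewrite ∪-identityʳ p = ≤-refl
∣p∪⁅x⁆∣≤suc∣p∣ (inside  ∷ p) (suc x) = s≤s (∣p∪⁅x⁆∣≤suc∣p∣ p x)
∣p∪⁅x⁆∣≤suc∣p∣ (outside ∷ p) (suc x) = ∣p∪⁅x⁆∣≤suc∣p∣ p x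

∣p-x∪⁅y⁆∣≤∣p∣ : {p : Subset n} {x : Fin n} (y : Fin n) → x ∈ p → ∣ (p - x) ∪ ⁅ y ⁆ ∣ ≤ ∣ p ∣
∣p-x∪⁅y⁆∣≤∣p∣ {p = p} {x} y x∈p = ≤-trans (∣p∪⁅x⁆∣≤suc∣p∣ (p - x) y) (x∈p⇒∣p-x∣<∣p∣ x∈p)

⊂-wellFounded : WellFounded (_⊂_ {n})
⊂-wellFounded = Subrelation.wellFounded p⊂q⇒∣p∣<∣q∣ (On.wellFounded ∣_∣ <-wellFounded)

module _ (K : SimplicialComplex n) where

  nonFace⇒missingFace⊆ : (S : Subset n) → ¬ face K S → ∃ λ M → M ⊆ S × MissingFace K M
  nonFace⇒missingFace⊆ S = go S (⊂-wellFounded S)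
    where
    go : (S : Subset n) → Acc _⊂_ S → ¬ face K S → ∃ λ M → M ⊆ S × MissingFace K M
    go S (acc smaller) S∉K with any? (λ x → x ∈? S ×-dec ¬? (face? K (S - x)))
    ... | yes (x , x∈S , S-x∉K) =
      let (M , M⊆S-x , M-missing) = go (S - x) (smaller (x∈p⇒p-x⊂p x∈S)) S-x∉K
      in  M , ⊆-trans M⊆S-x (p─q⊆p S ⁅ x ⁆) , M-missing
    ... | no noNonFaceDeletion = S , ⊆-refl , S∉K , properSubsetIsFace
      where
      properSubsetIsFace : ∀ S′ → S′ ⊂ S → face K S′
      properSubsetIsFace S′ (S′⊆S , x , x∈S , x∉S′) =
        downClosed K (p⊆q∧x∉p⇒p⊆q-x S′⊆S x∉S′)
          (decidable-stable (face? K (S - x)) λ S-x∉K → noNonFaceDeletion (x , x∈S , S-x∉K))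

  face-v₀∧face-v₁⇒face : {v₀ v₁ : Fin n} {G : Subset n} → Admissible K v₀ v₁ → DimAtMostDimK K G →
                         face K (G - v₀) → face K (G - v₁) → face K G
  face-v₀∧face-v₁⇒face {v₀} {v₁} {G} (_ , noAdmissibleMissingFace) (S , S∈K , ∣G∣≤∣S∣) G-v₀∈K G-v₁∈K =
    decidable-stable (face? K G) λ G∉K →
      let (M , M⊆G , M∉K , M-minimal) = nonFace⇒missingFace⊆ G G∉K
          ∈M : ∀ v → face K (G - v) → v ∈ M
          ∈M v G-v∈K = decidable-stable (v ∈? M) λ v∉M →
            M∉K (downClosed K (p⊆q∧x∉p⇒p⊆q-x M⊆G v∉M) G-v∈K)
      in  noAdmissibleMissingFace M (M∉K , M-minimal) (S , S∈K , ≤-trans (p⊆q⇒∣p∣≤∣q∣ M⊆G) ∣G∣≤∣S∣)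
            (∈M v₀ G-v₀∈K) (∈M v₁ G-v₁∈K)

mainTheorem5 : (n : ℕ) (K : SimplicialComplex n) (v₀ v₁ : Fin n) →
    Admissible K v₀ v₁ →
    (F : Subset n) → ContractedFace K v₀ v₁ F → ¬ face K F →
    (v : Fin n) → v ∈ F →
    (face K (F - v) → face K ((F - v) ∪ ⁅ v₀ ⁆)) × (face K ((F - v) ∪ ⁅ v₀ ⁆) → face K (F - v))
mainTheorem5 _ _ _ _ _ _ (inj₁ (_ , F∈K)) F∉K _ _ = ⊥-elim (F∉K F∈K)
mainTheorem5 n K v₀ v₁ adm F (inj₂ (T , v₀∈T , T∈K , refl)) _ v v∈F =
  (λ F-v∈K → face-v₀∧face-v₁⇒face K adm (T , T∈K , ∣G∣≤∣T∣)
               (downClosed K (p∪⁅x⁆-x⊆p (F - v) v₀) F-v∈K) (downClosed K G-v₁⊆T T∈K)) ,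
  downClosed K (p⊆p∪q ⁅ v₀ ⁆)
  where
  G : Subset n
  G = (F - v) ∪ ⁅ v₀ ⁆

  ∣G∣≤∣T∣ : ∣ G ∣ ≤ ∣ T ∣
  ∣G∣≤∣T∣ = ≤-trans (∣p-x∪⁅y⁆∣≤∣p∣ v₀ v∈F) (∣p-x∪⁅y⁆∣≤∣p∣ v₁ v₀∈T)

  G-v₁⊆T : G - v₁ ⊆ T
  G-v₁⊆T x∈G-v₁ with x∈p∪q⁻ (F - v) ⁅ v₀ ⁆ (p─q⊆p G ⁅ v₁ ⁆ x∈G-v₁)
  ... | inj₁ x∈F-v  = p─q⊆p T ⁅ v₀ ⁆ (p∪⁅x⁆-x⊆p (T - v₀) v₁
                        (x∈p∧x≢y⇒x∈p-y (p─q⊆p F ⁅ v ⁆ x∈F-v) (x∈p-y⇒x≢y x∈G-v₁)))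
  ... | inj₂ x∈⁅v₀⁆ = subst (_∈ T) (sym (x∈⁅y⁆⇒x≡y v₀ x∈⁅v₀⁆)) v₀∈T
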